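{- For any integers $0\leq k\leq n-1$, $$p_{n;\leq n-k}=\sum_{i=0}^{k+1}(-1)^{i}\binom{n}{i}(n-i+1)^{n-i-1}(k+1-i)^{i}.$$
   Context: There are $n$ parking spaces in a line numbered $1,\dots,n$; $n$ cars arrive in order, car $j$ has preference $a_j\in[n]$ and parks in the first unoccupied space numbered $\geq a_j$, if any; $(a_1,\dots,a_n)$ is a parking function if all cars park. $p_{n;\leq s}$ is the number of parking functions of length $n$ with all $a_j\leq s$. -}

module Defs where

open import Data.Nat using (ℕ; zero; suc; _+_; _∸_; _≤_; _≤?_; _<_)
open import Data.Bool using (Bool; true; false; if_then_else_)
open import Data.List using (List; []; _∷_; map; concatMap; length; filter; upTo; sum)
open import Data.Maybe using (Maybe; just; nothing; _>>=_; is-just)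
open import Data.Integer as ℤ using (ℤ; +_; -_)
open import Data.Nat.Combinatorics using (_C_)
open import Relation.Nullary.Decidable using (does)
open import Relation.Binary.PropositionalEquality using (_≡_)

-- Occupancy of spaces 1..n as a list of booleans (true = occupied),
-- spaces listed in increasing order.  'parkFrom a occ' parks a car with
-- preference a (1-based) in the first unoccupied space numbered ≥ a.
-- The first argument is the label of the first space in the list.
parkAt : ℕ → ℕ → List Bool → Maybe (List Bool)
parkAt pos a [] = nothing
parkAt pos a (false ∷ occ) with does (a ≤? pos)
... | true  = just (true ∷ occ)
... | false = Data.Maybe.map (false ∷_) (parkAt (suc pos) a occ)
parkAt pos a (true ∷ occ) = Data.Maybe.map (true ∷_) (parkAt (suc pos) a occ)

runCars : List ℕ → List Bool → Maybe (List Bool)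
runCars [] occ = just occ
runCars (a ∷ as) occ = parkAt 1 a occ >>= runCars as

emptyLot : ℕ → List Bool
emptyLot zero = []
emptyLot (suc n) = false ∷ emptyLot n

isParking : ℕ → List ℕ → Bool
isParking n as = is-just (runCars as (emptyLot n))

seqs : ℕ → ℕ → List (List ℕ)
seqs s zero = [] ∷ []
seqs s (suc m) = concatMap (λ a → map (a ∷_) (seqs s m)) (map suc (upTo s))

-- p_{n;≤s}: number of parking functions of length n with all aⱼ ≤ s
-- (for s ≤ n every such sequence has entries in [n])
p≤ : ℕ → ℕ → ℕ
p≤ n s = length (filter (λ as → isParking n as ≡? true) (seqs s n))
  where
  open import Data.Bool.Properties using () renaming (_≟_ to _≡?_)

_^ℤ_ : ℤ → ℕ → ℤ
x ^ℤ zero = + 1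
x ^ℤ suc k = x ℤ.* (x ^ℤ k)

sign : ℕ → ℤ
sign zero = + 1
sign (suc i) = - sign i

Σ≤ : ℕ → (ℕ → ℤ) → ℤ
Σ≤ m f = Data.List.foldr ℤ._+_ (+ 0) (map f (upTo (suc m)))

module Submission where

-- A sequence of n preferences is a parking function iff for every i ≤ n at least
-- i preferences are ≤ i (ParkingProcess, CountingCriterion).  Sorting {1,…,s}ⁿ by
-- the first violated condition gives  sⁿ = p_{n;≤s} + Σ_{t<n} C(n,t) PF(t) (s−t−1)^(n−t),
-- PF(t) the number of parking functions of length t (SequenceSums, FirstFailure).
-- For s > n no sequence passes, so Σ_{t≤n} C(n,t) PF(t) (z−t)^(n−t) = (z+1)ⁿ at
-- every natural z ≥ n, hence at every integer z by a finite-difference argument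
-- (FiniteDifferences, BinomialSums, AbelIdentity).  At z = −1 this identity yields
-- Cayley's formula PF(t) = (t+1)^(t−1) (Cayley).  For s = n − k the decomposition
-- and the identity at z = s − 1 share their terms t < s, so p_{n;≤s} is the sum of
-- the Abel terms t = n − i, i ≤ k, which are the summands of the corollary
-- (ParkingTail); the summand i = k + 1 vanishes.

open import Algebra.Structures using (IsCommutativeMonoid)
open import Data.List using (_∷_; map; applyUpTo)
open import Data.Nat using (ℕ; zero; suc)
open import Function using (_∘_; id)
open import Relation.Binary.PropositionalEquality

map-applyUpTo : ∀ {A B : Set} (f : A → B) (g : ℕ → A) n → map f (applyUpTo g n) ≡ applyUpTo (f ∘ g) n
map-applyUpTo f g zero    = refl
map-applyUpTo f g (suc n) = cong (f (g 0) ∷_) (map-applyUpTo f (g ∘ suc) n)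

module ParkingProcess where

  open import Defs
  open import Data.Bool using (Bool; true; false; T)
  open import Data.Maybe using (just; nothing; is-just)
  open import Data.Maybe.Properties using (just-injective)
  open import Data.List using (List; []; _∷_)
  open import Data.Nat using (ℕ; suc; _+_; _≤_; _<_; z≤n; s≤s; _≤ᵇ_; _≤?_)
  open import Data.Nat.Properties
  open import Data.Sum using (_⊎_; inj₁; inj₂)
  open import Data.Product using (_×_; _,_; proj₁; proj₂)
  open import Data.Empty using (⊥-elim)
  open import Data.Unit using (tt)
  open import Relation.Nullary using (¬_; yes; no)
  open import Relation.Binary.PropositionalEquality

  ≤ᵇ-true⇒≤ : ∀ {m n} → (m ≤ᵇ n) ≡ true → m ≤ n
  ≤ᵇ-true⇒≤ {m} {n} e = ≤ᵇ⇒≤ m n (subst T (sym e) tt)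

  ≤ᵇ-false⇒≰ : ∀ {m n} → (m ≤ᵇ n) ≡ false → ¬ m ≤ n
  ≤ᵇ-false⇒≰ e m≤n = subst T e (≤⇒≤ᵇ m≤n)

  ≤⇒≤ᵇ-true : ∀ {m n} → m ≤ n → (m ≤ᵇ n) ≡ true
  ≤⇒≤ᵇ-true {m} {n} m≤n with m ≤ᵇ n in e
  ... | true  = refl
  ... | false = ⊥-elim (≤ᵇ-false⇒≰ e m≤n)

  ≰⇒≤ᵇ-false : ∀ {m n} → ¬ m ≤ n → (m ≤ᵇ n) ≡ false
  ≰⇒≤ᵇ-false {m} {n} m≰n with m ≤ᵇ n in e
  ... | true  = ⊥-elim (m≰n (≤ᵇ-true⇒≤ e))
  ... | false = refl

  𝟙 : Bool → ℕ
  𝟙 true  = 1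
  𝟙 false = 0

  free : ℕ → ℕ → List Bool → ℕ
  free j pos []            = 0
  free j pos (true ∷ occ)  = free j (suc pos) occ
  free j pos (false ∷ occ) = 𝟙 (j ≤ᵇ pos) + free j (suc pos) occ

  #≥ : ℕ → List ℕ → ℕ
  #≥ j []       = 0
  #≥ j (a ∷ as) = 𝟙 (j ≤ᵇ a) + #≥ j as

  free-low : ∀ j k pos occ → j ≤ pos → k ≤ pos → free j pos occ ≡ free k pos occ
  free-low j k pos []            _   _   = refl
  free-low j k pos (true ∷ occ)  j≤p k≤p = free-low j k (suc pos) occ (m≤n⇒m≤1+n j≤p) (m≤n⇒m≤1+n k≤p)
  free-low j k pos (false ∷ occ) j≤p k≤p
    rewrite ≤⇒≤ᵇ-true j≤p | ≤⇒≤ᵇ-true k≤p =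
      cong suc (free-low j k (suc pos) occ (m≤n⇒m≤1+n j≤p) (m≤n⇒m≤1+n k≤p))

  𝟙≤ : ∀ {j a} → j ≤ a → 𝟙 (j ≤ᵇ a) ≡ 1
  𝟙≤ j≤a rewrite ≤⇒≤ᵇ-true j≤a = refl

  𝟙> : ∀ {j a} → a < j → 𝟙 (j ≤ᵇ a) ≡ 0
  𝟙> a<j rewrite ≰⇒≤ᵇ-false (<⇒≱ a<j) = refl

  #≥-antitone : ∀ i j as → i ≤ j → #≥ j as ≤ #≥ i as
  #≥-antitone i j []       _   = z≤n
  #≥-antitone i j (a ∷ as) i≤j with j ≤ᵇ a in e
  ... | true  rewrite 𝟙≤ (≤-trans i≤j (≤ᵇ-true⇒≤ e)) = s≤s (#≥-antitone i j as i≤j)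
  ... | false = ≤-trans (#≥-antitone i j as i≤j) (m≤n+m (#≥ i as) (𝟙 (i ≤ᵇ a)))

  parkAt-takes : ∀ pos a occ → a ≤ pos → parkAt pos a (false ∷ occ) ≡ just (true ∷ occ)
  parkAt-takes pos a occ a≤p rewrite ≤⇒≤ᵇ-true a≤p = refl

  parkAt-passes : ∀ pos a occ → ¬ a ≤ pos →
                  parkAt pos a (false ∷ occ) ≡ Data.Maybe.map (false ∷_) (parkAt (suc pos) a occ)
  parkAt-passes pos a occ a≰p rewrite ≰⇒≤ᵇ-false a≰p = refl

  park-fails : ∀ pos a occ → parkAt pos a occ ≡ nothing → free a pos occ ≡ 0
  park-fails pos a []            _  = refl
  park-fails pos a (true ∷ occ)  eq with parkAt (suc pos) a occ in e
  ... | nothing = park-fails (suc pos) a occ e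
  park-fails pos a (false ∷ occ) eq with a ≤? pos
  ... | yes a≤p with () ← trans (sym (parkAt-takes pos a occ a≤p)) eq
  ... | no a≰p with parkAt (suc pos) a occ in e | trans (sym (parkAt-passes pos a occ a≰p)) eq
  ...   | nothing | _ rewrite ≰⇒≤ᵇ-false a≰p = park-fails (suc pos) a occ e

  -- The effect of parking a car with preference a, turning occ into occ':
  -- every count free j with j ≤ a drops by one; a count free j with a < j either
  -- stays, or drops by one and then equals free a (the car parked at a space ≥ j,
  -- so no free space lay in [a, j)).
  DropsBelow KeepsOrEmptiesAbove ParkEffect : ℕ → ℕ → List Bool → List Bool → Set
  DropsBelow pos a occ occ' = ∀ j → j ≤ a → free j pos occ ≡ suc (free j pos occ')
  KeepsOrEmptiesAbove pos a occ occ' =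
    ∀ j → a < j → (free j pos occ ≡ free j pos occ') ⊎
                  ((free j pos occ ≡ suc (free j pos occ')) × (free a pos occ ≡ free j pos occ))
  ParkEffect pos a occ occ' = DropsBelow pos a occ occ' × KeepsOrEmptiesAbove pos a occ occ'

  takes-effect : ∀ pos a occ → a ≤ pos → ParkEffect pos a (false ∷ occ) (true ∷ occ)
  takes-effect pos a occ a≤p = below , above
    where
    below : DropsBelow pos a (false ∷ occ) (true ∷ occ)
    below j j≤a rewrite ≤⇒≤ᵇ-true (≤-trans j≤a a≤p) = refl
    above : KeepsOrEmptiesAbove pos a (false ∷ occ) (true ∷ occ)
    above j a<j rewrite ≤⇒≤ᵇ-true a≤p with j ≤ᵇ pos in j≤ᵇp
    ... | true  = inj₂ (refl , cong suc (free-low a j (suc pos) occ (m≤n⇒m≤1+n a≤p) (m≤n⇒m≤1+n (≤ᵇ-true⇒≤ j≤ᵇp))))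
    ... | false = inj₁ refl

  passes-effect : ∀ pos a occ r → ¬ a ≤ pos →
                  ParkEffect (suc pos) a occ r → ParkEffect pos a (false ∷ occ) (false ∷ r)
  passes-effect pos a occ r a≰p (IH-below , IH-above) = below , above
    where
    below : DropsBelow pos a (false ∷ occ) (false ∷ r)
    below j j≤a = trans (cong (𝟙 (j ≤ᵇ pos) +_) (IH-below j j≤a)) (+-suc (𝟙 (j ≤ᵇ pos)) _)
    above : KeepsOrEmptiesAbove pos a (false ∷ occ) (false ∷ r)
    above j a<j rewrite ≰⇒≤ᵇ-false a≰p
                      | ≰⇒≤ᵇ-false (λ j≤p → a≰p (≤-trans (<⇒≤ a<j) j≤p)) = IH-above j a<j

  park-effect : ∀ pos a occ occ' → parkAt pos a occ ≡ just occ' → ParkEffect pos a occ occ'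
  park-effect pos a (true ∷ occ) occ' eq with parkAt (suc pos) a occ in e
  park-effect pos a (true ∷ occ) .(true ∷ r) refl | just r =
    park-effect (suc pos) a occ r e
  park-effect pos a (false ∷ occ) occ' eq with a ≤? pos
  ... | yes a≤p with refl ← just-injective (trans (sym (parkAt-takes pos a occ a≤p)) eq) =
    takes-effect pos a occ a≤p
  ... | no a≰p with parkAt (suc pos) a occ in e | trans (sym (parkAt-passes pos a occ a≰p)) eq
  ...   | just r | refl = passes-effect pos a occ r a≰p (park-effect (suc pos) a occ r e)

  HallCondition : List ℕ → List Bool → Set
  HallCondition as occ = ∀ j → #≥ j as ≤ free j 1 occ

  hall-sufficient : ∀ as occ → HallCondition as occ → is-just (runCars as occ) ≡ true
  hall-sufficient []       occ H = refl
  hall-sufficient (a ∷ as) occ H with parkAt 1 a occ in eq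
  ... | nothing = ⊥-elim (n≮0 (subst₂ _≤_ (cong (_+ #≥ a as) (𝟙≤ {a} ≤-refl)) (park-fails 1 a occ eq) (H a)))
  ... | just occ' = hall-sufficient as occ' H'
    where
    effect : ParkEffect 1 a occ occ'
    effect = park-effect 1 a occ occ' eq
    H' : HallCondition as occ'
    H' j with j ≤? a
    ... | yes j≤a = ≤-pred (subst₂ _≤_ (cong (_+ #≥ j as) (𝟙≤ j≤a)) (proj₁ effect j j≤a) (H j))
    ... | no j≰a with proj₂ effect j (≰⇒> j≰a)
    ...   | inj₁ same = subst₂ _≤_ (cong (_+ #≥ j as) (𝟙> (≰⇒> j≰a))) same (H j)
    ...   | inj₂ (drop , free-a≡free-j) =
      ≤-pred (≤-trans (s≤s (#≥-antitone a j as (<⇒≤ (≰⇒> j≰a))))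
                      (subst₂ _≤_ (cong (_+ #≥ a as) (𝟙≤ {a} ≤-refl)) (trans free-a≡free-j drop) (H a)))

  hall-necessary : ∀ as occ → is-just (runCars as occ) ≡ true → HallCondition as occ
  hall-necessary []       occ _  j = z≤n
  hall-necessary (a ∷ as) occ ok j with parkAt 1 a occ in eq
  hall-necessary (a ∷ as) occ () j | nothing
  ... | just occ' with j ≤? a
  ... | yes j≤a rewrite 𝟙≤ j≤a =
    subst (suc (#≥ j as) ≤_) (sym (proj₁ (park-effect 1 a occ occ' eq) j j≤a)) (s≤s (hall-necessary as occ' ok j))
  ... | no j≰a rewrite 𝟙> (≰⇒> j≰a) with proj₂ (park-effect 1 a occ occ' eq) j (≰⇒> j≰a)
  ...   | inj₁ same       = subst (#≥ j as ≤_) (sym same) (hall-necessary as occ' ok j)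
  ...   | inj₂ (drop , _) = subst (#≥ j as ≤_) (sym drop) (m≤n⇒m≤1+n (hall-necessary as occ' ok j))

module CountingCriterion where

  open import Defs
  open ParkingProcess
  open import Data.Bool using (Bool; true; _∧_)
  open import Data.Bool.Properties using (⇔→≡; ∧-conicalˡ; ∧-conicalʳ)
  open import Data.List using (List; []; _∷_; length)
  open import Data.Nat using (ℕ; zero; suc; _+_; _∸_; _≤_; _<_; z≤n; s≤s; _≤ᵇ_; _≤?_; _<?_)
  open import Data.Nat.Properties
  open import Data.Sum using (inj₁; inj₂)
  open import Function.Bundles using (mk⇔)
  open import Relation.Nullary using (yes; no)
  open import Relation.Binary.PropositionalEquality

  free-empty : ∀ j pos n → free j pos (emptyLot n) ≡ n ∸ (j ∸ pos)
  free-empty j pos zero = sym (0∸n≡0 (j ∸ pos))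
  free-empty j pos (suc n) with j ≤? pos
  ... | yes j≤p rewrite ≤⇒≤ᵇ-true j≤p | m≤n⇒m∸n≡0 j≤p =
    cong suc (trans (free-empty j (suc pos) n) (cong (n ∸_) (m≤n⇒m∸n≡0 (m≤n⇒m≤1+n j≤p))))
  ... | no j≰p rewrite ≰⇒≤ᵇ-false j≰p = trans (free-empty j (suc pos) n) (shift j pos (≰⇒> j≰p))
    where
    shift : ∀ j pos → pos < j → n ∸ (j ∸ suc pos) ≡ suc n ∸ (j ∸ pos)
    shift (suc j) zero    _         = refl
    shift (suc j) (suc pos) (s≤s p) = shift j pos p

  #≤ : ℕ → List ℕ → ℕ
  #≤ i []       = 0
  #≤ i (a ∷ as) = 𝟙 (a ≤ᵇ i) + #≤ i as

  #≥+#≤ : ∀ i as → #≥ (suc i) as + #≤ i as ≡ length as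
  #≥+#≤ i [] = refl
  #≥+#≤ i (a ∷ as) with i <? a
  ... | yes i<a rewrite 𝟙≤ i<a | 𝟙> i<a = cong suc (#≥+#≤ i as)
  ... | no i≮a rewrite 𝟙> {suc i} (s≤s (≮⇒≥ i≮a)) | 𝟙≤ (≮⇒≥ i≮a) =
    trans (+-suc (#≥ (suc i) as) _) (cong suc (#≥+#≤ i as))

  #≥-zero : ∀ as → #≥ 0 as ≡ length as
  #≥-zero []       = refl
  #≥-zero (a ∷ as) = cong suc (#≥-zero as)

  countsOk : ℕ → List ℕ → Bool
  countsOk zero    as = true
  countsOk (suc u) as = countsOk u as ∧ (suc u ≤ᵇ #≤ (suc u) as)

  countsOk-sound : ∀ u as → countsOk u as ≡ true → ∀ i → i ≤ u → i ≤ #≤ i as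
  countsOk-sound zero    as _  .zero z≤n = z≤n
  countsOk-sound (suc u) as ok i i≤1+u with m≤n⇒m<n∨m≡n i≤1+u
  ... | inj₁ (s≤s i≤u) = countsOk-sound u as (∧-conicalˡ _ _ ok) i i≤u
  ... | inj₂ refl      = ≤ᵇ-true⇒≤ (∧-conicalʳ (countsOk u as) _ ok)

  countsOk-complete : ∀ u as → (∀ i → i ≤ u → i ≤ #≤ i as) → countsOk u as ≡ true
  countsOk-complete zero    as H = refl
  countsOk-complete (suc u) as H
    rewrite countsOk-complete u as (λ i i≤u → H i (m≤n⇒m≤1+n i≤u))
          | ≤⇒≤ᵇ-true (H (suc u) ≤-refl) = refl

  isParking≡countsOk : ∀ n as → length as ≡ n → isParking n as ≡ countsOk n as
  isParking≡countsOk n as len = ⇔→≡ {z = true} (mk⇔ to from)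
    where
    condition-from-hall : ∀ i → i ≤ n → (#≥ (suc i) as ≤ n ∸ i) → i ≤ #≤ i as
    condition-from-hall i i≤n h = begin
      i                                  ≡⟨ m∸[m∸n]≡n i≤n ⟨
      n ∸ (n ∸ i)                        ≤⟨ ∸-monoʳ-≤ n h ⟩
      n ∸ #≥ (suc i) as                  ≡⟨ cong (_∸ #≥ (suc i) as) (trans (sym len) (sym (#≥+#≤ i as))) ⟩
      #≥ (suc i) as + #≤ i as ∸ #≥ (suc i) as ≡⟨ m+n∸m≡n (#≥ (suc i) as) (#≤ i as) ⟩
      #≤ i as                            ∎
      where open ≤-Reasoning
    to : isParking n as ≡ true → countsOk n as ≡ true
    to parks = countsOk-complete n as λ i i≤n →
      condition-from-hall i i≤n (subst (#≥ (suc i) as ≤_) (free-empty (suc i) 1 n) (hall-necessary as (emptyLot n) parks (suc i)))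
    hall-bound : countsOk n as ≡ true → ∀ i → i ≤ n → #≥ (suc i) as ≤ n ∸ i
    hall-bound ok i i≤n = m+n≤o⇒m≤o∸n _ (begin
      #≥ (suc i) as + i       ≤⟨ +-monoʳ-≤ (#≥ (suc i) as) (countsOk-sound n as ok i i≤n) ⟩
      #≥ (suc i) as + #≤ i as ≡⟨ trans (#≥+#≤ i as) len ⟩
      n                       ∎)
      where open ≤-Reasoning
    from : countsOk n as ≡ true → isParking n as ≡ true
    from ok = hall-sufficient as (emptyLot n) λ j → subst (#≥ j as ≤_) (sym (free-empty j 1 n)) (bound j)
      where
      bound : ∀ j → #≥ j as ≤ n ∸ (j ∸ 1)
      bound zero = ≤-reflexive (trans (#≥-zero as) len)
      bound (suc i) with i ≤? n
      ... | yes i≤n = hall-bound ok i i≤n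
      ... | no i≰n  = ≤-trans (#≥-antitone (suc n) (suc i) as (s≤s (<⇒≤ (≰⇒> i≰n))))
                        (≤-trans (hall-bound ok n ≤-refl) (≤-reflexive (trans (n∸n≡0 n) (sym (m≤n⇒m∸n≡0 (<⇒≤ (≰⇒> i≰n)))))))

module RangeSum {A : Set} {_+_ : A → A → A} {0# : A}
                (isCM : IsCommutativeMonoid (_≡_ {A = A}) _+_ 0#) where

  open IsCommutativeMonoid isCM using (assoc; comm; identityˡ; identityʳ)
  open import Data.Nat using (ℕ; zero; suc; _<_; _∸_; z≤n; s≤s) renaming (_+_ to _+ℕ_)
  open import Data.List using (foldr; applyUpTo)
  open import Function using (_∘_)
  open ≡-Reasoning

  Σ< : ℕ → (ℕ → A) → A
  Σ< zero    f = 0#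
  Σ< (suc n) f = f 0 + Σ< n (f ∘ suc)

  Σ<-cong : ∀ n {f g} → (∀ i → i < n → f i ≡ g i) → Σ< n f ≡ Σ< n g
  Σ<-cong zero    _  = refl
  Σ<-cong (suc n) eq = cong₂ _+_ (eq 0 (s≤s z≤n)) (Σ<-cong n (λ i i<n → eq (suc i) (s≤s i<n)))

  Σ<-zero : ∀ n → Σ< n (λ _ → 0#) ≡ 0#
  Σ<-zero zero    = refl
  Σ<-zero (suc n) = trans (identityˡ _) (Σ<-zero n)

  interchange : ∀ a b c d → (a + b) + (c + d) ≡ (a + c) + (b + d)
  interchange a b c d = begin
    (a + b) + (c + d)  ≡⟨ assoc a b (c + d) ⟩
    a + (b + (c + d))  ≡⟨ cong (a +_) (assoc b c d) ⟨
    a + ((b + c) + d)  ≡⟨ cong (λ x → a + (x + d)) (comm b c) ⟩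
    a + ((c + b) + d)  ≡⟨ cong (a +_) (assoc c b d) ⟩
    a + (c + (b + d))  ≡⟨ assoc a c (b + d) ⟨
    (a + c) + (b + d)  ∎

  Σ<-+ : ∀ n f g → Σ< n (λ i → f i + g i) ≡ Σ< n f + Σ< n g
  Σ<-+ zero    f g = sym (identityˡ 0#)
  Σ<-+ (suc n) f g = trans (cong ((f 0 + g 0) +_) (Σ<-+ n (f ∘ suc) (g ∘ suc))) (interchange (f 0) (g 0) _ _)

  Σ<-split : ∀ t u f → Σ< (t +ℕ u) f ≡ Σ< t f + Σ< u (λ i → f (t +ℕ i))
  Σ<-split zero    u f = sym (identityˡ _)
  Σ<-split (suc t) u f = trans (cong (f 0 +_) (Σ<-split t u (f ∘ suc))) (sym (assoc (f 0) _ _))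

  Σ<-last : ∀ n f → Σ< (suc n) f ≡ Σ< n f + f n
  Σ<-last zero    f = trans (identityʳ (f 0)) (sym (identityˡ (f 0)))
  Σ<-last (suc n) f = trans (cong (f 0 +_) (Σ<-last n (f ∘ suc))) (sym (assoc (f 0) _ _))

  Σ<-reverse : ∀ n f → Σ< n f ≡ Σ< n (λ i → f (n ∸ suc i))
  Σ<-reverse zero    f = refl
  Σ<-reverse (suc n) f = begin
    Σ< (suc n) f                       ≡⟨ Σ<-last n f ⟩
    Σ< n f + f n                       ≡⟨ cong (_+ f n) (Σ<-reverse n f) ⟩
    Σ< n (λ i → f (n ∸ suc i)) + f n   ≡⟨ comm _ (f n) ⟩
    f n + Σ< n (λ i → f (n ∸ suc i))   ∎

  foldr-applyUpTo : ∀ (f : ℕ → A) n → foldr _+_ 0# (applyUpTo f n) ≡ Σ< n f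
  foldr-applyUpTo f zero    = refl
  foldr-applyUpTo f (suc n) = cong (f 0 +_) (foldr-applyUpTo (f ∘ suc) n)

module SequenceSums where

  open import Defs
  open import Data.Bool using (if_then_else_)
  open import Data.List using (List; []; _∷_; map; _++_; concatMap; applyUpTo; length)
  open import Data.List.Relation.Unary.All using (All; []; _∷_)
  open import Data.Nat using (ℕ; zero; suc; _+_; _*_; _∸_; _^_; _≤_; _<_; s≤s; _≤ᵇ_; _<?_)
  open import Data.Nat.Properties
  open import Data.Nat.Combinatorics using (_C_; nCk+nC[k+1]≡[n+1]C[k+1]; k>n⇒nCk≡0)
  open import Data.Empty using (⊥-elim)
  open import Function using (_∘_)
  open import Relation.Nullary using (yes; no)
  open import Relation.Binary.PropositionalEquality
  open ParkingProcess using (≤⇒≤ᵇ-true; ≰⇒≤ᵇ-false)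
  open RangeSum +-0-isCommutativeMonoid

  total : (List ℕ → ℕ) → List (List ℕ) → ℕ
  total W []       = 0
  total W (x ∷ xs) = W x + total W xs

  total-++ : ∀ W xs ys → total W (xs ++ ys) ≡ total W xs + total W ys
  total-++ W []       ys = refl
  total-++ W (x ∷ xs) ys = trans (cong (W x +_) (total-++ W xs ys)) (sym (+-assoc (W x) _ _))

  total-map-∷ : ∀ W a ys → total W (map (a ∷_) ys) ≡ total (W ∘ (a ∷_)) ys
  total-map-∷ W a []       = refl
  total-map-∷ W a (y ∷ ys) = cong (W (a ∷ y) +_) (total-map-∷ W a ys)

  total-cong : ∀ {W V} xs → (∀ l → W l ≡ V l) → total W xs ≡ total V xs
  total-cong []       eq = refl
  total-cong (x ∷ xs) eq = cong₂ _+_ (eq x) (total-cong xs eq)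

  total-+ : ∀ W V xs → total (λ l → W l + V l) xs ≡ total W xs + total V xs
  total-+ W V []       = refl
  total-+ W V (x ∷ xs) = trans (cong (W x + V x +_) (total-+ W V xs)) (interchange (W x) (V x) _ _)

  total-zero : ∀ xs → total (λ _ → 0) xs ≡ 0
  total-zero []       = refl
  total-zero (x ∷ xs) = total-zero xs

  total-seqs : ∀ W s m → total W (seqs s (suc m)) ≡ Σ< s (λ i → total (W ∘ (suc i ∷_)) (seqs s m))
  total-seqs W s m rewrite map-applyUpTo suc id s = by-first-entry suc s
    where
    by-first-entry : ∀ (h : ℕ → ℕ) k →
      total W (concatMap (λ a → map (a ∷_) (seqs s m)) (applyUpTo h k)) ≡ Σ< k (λ i → total (W ∘ (h i ∷_)) (seqs s m))
    by-first-entry h zero    = refl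
    by-first-entry h (suc k) = trans (total-++ W (map (h 0 ∷_) (seqs s m)) _)
                                     (cong₂ _+_ (total-map-∷ W (h 0) (seqs s m)) (by-first-entry (h ∘ suc) k))

  total-seqs-cong : ∀ s n {W V} → (∀ l → length l ≡ n → All (_≤ s) l → W l ≡ V l) →
                    total W (seqs s n) ≡ total V (seqs s n)
  total-seqs-cong s zero    eq = cong (_+ 0) (eq [] refl [])
  total-seqs-cong s (suc n) {W} {V} eq = begin
    total W (seqs s (suc n))                            ≡⟨ total-seqs W s n ⟩
    Σ< s (λ i → total (W ∘ (suc i ∷_)) (seqs s n))      ≡⟨ Σ<-cong s (λ i i<s → total-seqs-cong s n
                                                              (λ l len al → eq (suc i ∷ l) (cong suc len) (i<s ∷ al))) ⟩
    Σ< s (λ i → total (V ∘ (suc i ∷_)) (seqs s n))      ≡⟨ total-seqs V s n ⟨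
    total V (seqs s (suc n))                            ∎
    where open ≡-Reasoning

  Σ<-const : ∀ n c → Σ< n (λ _ → c) ≡ n * c
  Σ<-const zero    c = refl
  Σ<-const (suc n) c = cong (c +_) (Σ<-const n c)

  #seqs : ∀ s n → total (λ _ → 1) (seqs s n) ≡ s ^ n
  #seqs s zero    = refl
  #seqs s (suc n) = trans (total-seqs (λ _ → 1) s n) (trans (Σ<-cong s (λ i _ → #seqs s n)) (Σ<-const s (s ^ n)))

  -- Binomial convolution: conv n p q = Σ_{t ≤ n} C(n,t) · p t · q (n ∸ t)
  -- (see conv-δ), defined by the Pascal recursion that a count over the
  -- sequences of length n produces when its first entry is removed.
  conv : ℕ → (ℕ → ℕ) → (ℕ → ℕ) → ℕ
  conv zero    p q = p 0 * q 0
  conv (suc n) p q = conv n (p ∘ suc) q + conv n p (q ∘ suc)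

  conv-cong : ∀ n {p p′ q q′} → (∀ r → p r ≡ p′ r) → (∀ r → q r ≡ q′ r) → conv n p q ≡ conv n p′ q′
  conv-cong zero    eqp eqq = cong₂ _*_ (eqp 0) (eqq 0)
  conv-cong (suc n) eqp eqq = cong₂ _+_ (conv-cong n (eqp ∘ suc) eqq) (conv-cong n eqp (eqq ∘ suc))

  conv-comm : ∀ n p q → conv n p q ≡ conv n q p
  conv-comm zero    p q = *-comm (p 0) (q 0)
  conv-comm (suc n) p q = trans (cong₂ _+_ (conv-comm n (p ∘ suc) q) (conv-comm n p (q ∘ suc)))
                                (+-comm (conv n q (p ∘ suc)) _)

  conv-zeroˡ : ∀ n q → conv n (λ _ → 0) q ≡ 0
  conv-zeroˡ zero    q = refl
  conv-zeroˡ (suc n) q = cong₂ _+_ (conv-zeroˡ n q) (conv-zeroˡ n (q ∘ suc))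

  conv-+ˡ : ∀ n p p′ q → conv n (λ r → p r + p′ r) q ≡ conv n p q + conv n p′ q
  conv-+ˡ zero    p p′ q = *-distribʳ-+ (q 0) (p 0) (p′ 0)
  conv-+ˡ (suc n) p p′ q = trans (cong₂ _+_ (conv-+ˡ n (p ∘ suc) (p′ ∘ suc) q) (conv-+ˡ n p p′ (q ∘ suc)))
                                 (interchange (conv n (p ∘ suc) q) _ _ _)

  conv-Σˡ : ∀ m n (p : ℕ → ℕ → ℕ) q → conv n (λ r → Σ< m (λ i → p i r)) q ≡ Σ< m (λ i → conv n (p i) q)
  conv-Σˡ zero    n p q = conv-zeroˡ n q
  conv-Σˡ (suc m) n p q = trans (conv-+ˡ n (p 0) _ q) (cong (conv n (p 0) q +_) (conv-Σˡ m n (p ∘ suc) q))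

  conv-Σʳ : ∀ m n p (q : ℕ → ℕ → ℕ) → conv n p (λ r → Σ< m (λ i → q i r)) ≡ Σ< m (λ i → conv n p (q i))
  conv-Σʳ m n p q = trans (conv-comm n p _) (trans (conv-Σˡ m n q p) (Σ<-cong m (λ i _ → conv-comm n (q i) p)))

  δ : ℕ → ℕ → ℕ → ℕ
  δ zero    c zero    = c
  δ zero    c (suc r) = 0
  δ (suc t) c zero    = 0
  δ (suc t) c (suc r) = δ t c r

  δ-at : ∀ t c → δ t c t ≡ c
  δ-at zero    c = refl
  δ-at (suc t) c = δ-at t c

  δ-off : ∀ t c r → r ≢ t → δ t c r ≡ 0
  δ-off zero    c zero    r≢t = ⊥-elim (r≢t refl)
  δ-off zero    c (suc r) _   = refl
  δ-off (suc t) c zero    _   = refl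
  δ-off (suc t) c (suc r) r≢t = δ-off t c r (r≢t ∘ cong suc)

  ∸-suc : ∀ n t → t < n → n ∸ t ≡ suc (n ∸ suc t)
  ∸-suc (suc n) zero    _       = refl
  ∸-suc (suc n) (suc t) (s≤s p) = ∸-suc n t p

  conv-δ : ∀ n t c q → conv n (δ t c) q ≡ (n C t) * c * q (n ∸ t)
  conv-δ zero    zero    c q = cong (_* q 0) (sym (+-identityʳ c))
  conv-δ zero    (suc t) c q = refl
  conv-δ (suc n) zero    c q rewrite conv-zeroˡ n q | conv-δ n zero c (q ∘ suc) = refl
  conv-δ (suc n) (suc t) c q rewrite conv-δ n t c q | conv-δ n (suc t) c (q ∘ suc) = begin
    (n C t) * c * q (n ∸ t) + (n C suc t) * c * q (suc (n ∸ suc t))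
      ≡⟨ cong ((n C t) * c * q (n ∸ t) +_) same-power ⟩
    (n C t) * c * q (n ∸ t) + (n C suc t) * c * q (n ∸ t)
      ≡⟨ *-distribʳ-+ (q (n ∸ t)) ((n C t) * c) _ ⟨
    ((n C t) * c + (n C suc t) * c) * q (n ∸ t)
      ≡⟨ cong (_* q (n ∸ t)) (*-distribʳ-+ c (n C t) _) ⟨
    (n C t + n C suc t) * c * q (n ∸ t)
      ≡⟨ cong (λ x → x * c * q (n ∸ t)) (nCk+nC[k+1]≡[n+1]C[k+1] n t) ⟩
    (suc n C suc t) * c * q (n ∸ t) ∎
    where
    open ≡-Reasoning
    -- for t < n the indices agree; otherwise C(n, t+1) = 0
    same-power : (n C suc t) * c * q (suc (n ∸ suc t)) ≡ (n C suc t) * c * q (n ∸ t)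
    same-power with t <? n
    ... | yes t<n = cong (λ x → (n C suc t) * c * q x) (sym (∸-suc n t t<n))
    ... | no t≮n rewrite k>n⇒nCk≡0 {n} {suc t} (s≤s (≮⇒≥ t≮n)) = refl

  small : ℕ → List ℕ → List ℕ
  small t []       = []
  small t (a ∷ as) = if a ≤ᵇ t then a ∷ small t as else small t as

  large : ℕ → List ℕ → List ℕ
  large t []       = []
  large t (a ∷ as) = if a ≤ᵇ t then large t as else (a ∸ t) ∷ large t as

  -- A count over {1,…,t+u}ⁿ of a weight that factors through the small and the
  -- large part is the binomial convolution of the counts over {1,…,t}ʳ and
  -- {1,…,u}ʳ: choose which positions carry small entries.
  split-count : ∀ t u n (P Q : List ℕ → ℕ) →
    total (λ l → P (small t l) * Q (large t l)) (seqs (t + u) n) ≡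
    conv n (λ r → total P (seqs t r)) (λ r → total Q (seqs u r))
  split-count t u zero    P Q = trans (+-identityʳ _) (sym (cong₂ _*_ (+-identityʳ (P [])) (+-identityʳ (Q []))))
  split-count t u (suc n) P Q = begin
    total W (seqs (t + u) (suc n))
      ≡⟨ total-seqs W (t + u) n ⟩
    Σ< (t + u) (λ i → total (W ∘ (suc i ∷_)) (seqs (t + u) n))
      ≡⟨ Σ<-split t u _ ⟩
    Σ< t (λ i → total (W ∘ (suc i ∷_)) (seqs (t + u) n)) + Σ< u (λ i → total (W ∘ (suc (t + i) ∷_)) (seqs (t + u) n))
      ≡⟨ cong₂ _+_ (Σ<-cong t (λ i i<t → trans (total-cong (seqs (t + u) n) (small-first i i<t))
                                              (split-count t u n (P ∘ (suc i ∷_)) Q)))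
                   (Σ<-cong u (λ i _ → trans (total-cong (seqs (t + u) n) (large-first i))
                                              (split-count t u n P (Q ∘ (suc i ∷_))))) ⟩
    Σ< t (λ i → conv n (λ r → total (P ∘ (suc i ∷_)) (seqs t r)) countQ)
      + Σ< u (λ i → conv n countP (λ r → total (Q ∘ (suc i ∷_)) (seqs u r)))
      ≡⟨ cong₂ _+_ (conv-Σˡ t n (λ i r → total (P ∘ (suc i ∷_)) (seqs t r)) countQ)
                   (conv-Σʳ u n countP (λ i r → total (Q ∘ (suc i ∷_)) (seqs u r))) ⟨
    conv n (λ r → Σ< t (λ i → total (P ∘ (suc i ∷_)) (seqs t r))) countQ
      + conv n countP (λ r → Σ< u (λ i → total (Q ∘ (suc i ∷_)) (seqs u r)))
      ≡⟨ cong₂ _+_ (conv-cong n (λ r → sym (total-seqs P t r)) (λ _ → refl))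
                   (conv-cong n (λ _ → refl) (λ r → sym (total-seqs Q u r))) ⟩
    conv n (countP ∘ suc) countQ + conv n countP (countQ ∘ suc) ∎
    where
    open ≡-Reasoning
    W : List ℕ → ℕ
    W l = P (small t l) * Q (large t l)
    countP countQ : ℕ → ℕ
    countP r = total P (seqs t r)
    countQ r = total Q (seqs u r)
    small-first : ∀ i → i < t → ∀ l → W (suc i ∷ l) ≡ P (suc i ∷ small t l) * Q (large t l)
    small-first i i<t l rewrite ≤⇒≤ᵇ-true i<t = refl
    large-first : ∀ i l → W (suc (t + i) ∷ l) ≡ P (small t l) * Q (suc i ∷ large t l)
    large-first i l rewrite ≰⇒≤ᵇ-false (<⇒≱ (s≤s (m≤m+n t i))) =
      cong (λ x → P (small t l) * Q (x ∷ large t l)) (trans (cong (_∸ t) (sym (+-suc t i))) (m+n∸m≡n t (suc i)))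

-- A sequence whose first failure is at t+1 has exactly t entries ≤ t, forming a
-- parking function of length t, and no entry equal to t+1; hence
--   sⁿ = p_{n;≤s} + Σ_{t<n} C(n,t) · PF(t) · (s − t − 1)^(n−t),
-- where PF(t) is the number of parking functions of length t.
module FirstFailure where

  open import Defs
  open import Data.Bool using (Bool; true; false; T; _∧_; not)
  open import Data.Bool.Properties using (∧-zeroʳ; ∧-identityʳ) renaming (_≟_ to _≟ᵇ_)
  open import Data.List using (List; []; _∷_; length; filter)
  open import Data.List.Relation.Unary.All using (All; []; _∷_)
  open import Data.Nat using (ℕ; zero; suc; _+_; _*_; _∸_; _^_; _≤_; _<_; z≤n; s≤s; _≤ᵇ_; _≡ᵇ_; _≤?_; _≟_)
  open import Data.Nat.Properties
  open import Data.Nat.Combinatorics using (_C_)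
  open import Data.Sum using (_⊎_; inj₁; inj₂)
  open import Data.Empty using (⊥-elim)
  open import Data.Unit using (tt)
  open import Function using (_∘_)
  open import Relation.Nullary using (yes; no)
  open import Relation.Binary.Definitions using (tri<; tri≈; tri>)
  open import Relation.Binary.PropositionalEquality
  open ParkingProcess
  open CountingCriterion
  open RangeSum +-0-isCommutativeMonoid
  open SequenceSums

  PF : ℕ → ℕ
  PF t = total (𝟙 ∘ countsOk t) (seqs t t)

  isPF : ℕ → List ℕ → ℕ
  isPF t l = 𝟙 ((length l ≡ᵇ t) ∧ countsOk t l)

  ≡ᵇ-refl : ∀ n → (n ≡ᵇ n) ≡ true
  ≡ᵇ-refl zero    = refl
  ≡ᵇ-refl (suc n) = ≡ᵇ-refl n

  ≢⇒≡ᵇ-false : ∀ {m n} → m ≢ n → (m ≡ᵇ n) ≡ false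
  ≢⇒≡ᵇ-false {m} {n} m≢n with m ≡ᵇ n in e
  ... | true  = ⊥-elim (m≢n (≡ᵇ⇒≡ m n (subst T (sym e) tt)))
  ... | false = refl

  total-isPF : ∀ t r → total (isPF t) (seqs t r) ≡ δ t (PF t) r
  total-isPF t r with r ≟ t
  ... | yes refl = trans (total-seqs-cong r r same) (sym (δ-at r (PF r)))
    where
    same : ∀ l → length l ≡ r → All (_≤ r) l → isPF r l ≡ 𝟙 (countsOk r l)
    same l len _ rewrite len | ≡ᵇ-refl r = refl
  ... | no r≢t = trans (total-seqs-cong t r none) (trans (total-zero (seqs t r)) (sym (δ-off t (PF t) r r≢t)))
    where
    none : ∀ l → length l ≡ r → All (_≤ t) l → isPF t l ≡ 0
    none l len _ rewrite len | ≢⇒≡ᵇ-false r≢t = refl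

  -- Indicator of "no entry equals 1" (entries are ≥ 1 throughout).
  avoids1 : List ℕ → ℕ
  avoids1 l = 𝟙 (#≤ 1 l ≡ᵇ 0)

  total-avoids1 : ∀ u r → total avoids1 (seqs u r) ≡ (u ∸ 1) ^ r
  total-avoids1 u       zero    = refl
  total-avoids1 zero    (suc r) = refl
  total-avoids1 (suc u) (suc r) = begin
    total avoids1 (seqs (suc u) (suc r))
      ≡⟨ total-seqs avoids1 (suc u) r ⟩
    total (λ _ → 0) (seqs (suc u) r) + Σ< u (λ i → total avoids1 (seqs (suc u) r))
      ≡⟨ cong₂ _+_ (total-zero (seqs (suc u) r)) (Σ<-cong u (λ i _ → total-avoids1 (suc u) r)) ⟩
    Σ< u (λ _ → u ^ r)
      ≡⟨ Σ<-const u (u ^ r) ⟩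
    u ^ suc r ∎
    where open ≡-Reasoning

  #≤-small : ∀ i t l → i ≤ t → #≤ i (small t l) ≡ #≤ i l
  #≤-small i t []      _   = refl
  #≤-small i t (a ∷ l) i≤t with a ≤? t
  ... | yes a≤t rewrite ≤⇒≤ᵇ-true a≤t = cong (𝟙 (a ≤ᵇ i) +_) (#≤-small i t l i≤t)
  ... | no a≰t rewrite ≰⇒≤ᵇ-false a≰t | 𝟙> {a} {i} (≤-<-trans i≤t (≰⇒> a≰t)) = #≤-small i t l i≤t

  length-small : ∀ t l → length (small t l) ≡ #≤ t l
  length-small t []      = refl
  length-small t (a ∷ l) with a ≤? t
  ... | yes a≤t rewrite ≤⇒≤ᵇ-true a≤t = cong suc (length-small t l)
  ... | no a≰t rewrite ≰⇒≤ᵇ-false a≰t = length-small t l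

  #≤-suc : ∀ t l → #≤ (suc t) l ≡ #≤ t l + #≤ 1 (large t l)
  #≤-suc t []      = refl
  #≤-suc t (a ∷ l) with <-cmp a (suc t)
  ... | tri< a<1+t _ _ rewrite 𝟙≤ {a} {suc t} (<⇒≤ a<1+t) | ≤⇒≤ᵇ-true (≤-pred a<1+t) = cong suc (#≤-suc t l)
  ... | tri≈ _ refl _ rewrite 𝟙≤ {suc t} {suc t} ≤-refl | ≰⇒≤ᵇ-false (1+n≰n {t})
                            | +-∸-assoc 1 (≤-refl {t}) | n∸n≡0 t =
    trans (cong suc (#≤-suc t l)) (sym (+-suc (#≤ t l) _))
  ... | tri> _ _ 1+t<a rewrite 𝟙> 1+t<a | ≰⇒≤ᵇ-false (<⇒≱ (<-trans (n<1+n t) 1+t<a))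
                             | 𝟙> {a ∸ t} {1} (m+n≤o⇒m≤o∸n 2 1+t<a) = #≤-suc t l

  countsOk-cong : ∀ u l l′ → (∀ i → i ≤ u → #≤ i l ≡ #≤ i l′) → countsOk u l ≡ countsOk u l′
  countsOk-cong zero    l l′ eq = refl
  countsOk-cong (suc u) l l′ eq =
    cong₂ _∧_ (countsOk-cong u l l′ (λ i i≤u → eq i (m≤n⇒m≤1+n i≤u))) (cong (suc u ≤ᵇ_) (eq (suc u) ≤-refl))

  countsOk-small : ∀ t l → countsOk t (small t l) ≡ countsOk t l
  countsOk-small t l = countsOk-cong t (small t l) l (λ i i≤t → #≤-small i t l i≤t)

  firstFail : ℕ → List ℕ → ℕ
  firstFail t l = 𝟙 (countsOk t l ∧ not (suc t ≤ᵇ #≤ (suc t) l))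

  fails-at-suc : ∀ L c t → t ≤ L → 𝟙 (not (suc t ≤ᵇ L + c)) ≡ 𝟙 (L ≡ᵇ t) * 𝟙 (c ≡ᵇ 0)
  fails-at-suc L (suc c) t t≤L
    rewrite ≤⇒≤ᵇ-true (subst (suc t ≤_) (sym (+-suc L c)) (s≤s (≤-trans t≤L (m≤m+n L c))))
          | *-zeroʳ (𝟙 (L ≡ᵇ t)) = refl
  fails-at-suc L zero t t≤L with L ≟ t
  ... | yes refl rewrite +-identityʳ L | ≰⇒≤ᵇ-false (1+n≰n {L}) | ≡ᵇ-refl L = refl
  ... | no L≢t rewrite +-identityʳ L | ≢⇒≡ᵇ-false L≢t | ≤⇒≤ᵇ-true (≤∧≢⇒< t≤L (L≢t ∘ sym)) = refl

  firstFail-factors : ∀ t l → firstFail t l ≡ isPF t (small t l) * avoids1 (large t l)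
  firstFail-factors t l with countsOk t l in ok
  ... | false rewrite countsOk-small t l | ok | ∧-zeroʳ (length (small t l) ≡ᵇ t) = refl
  ... | true rewrite countsOk-small t l | ok | ∧-identityʳ (length (small t l) ≡ᵇ t) | length-small t l | #≤-suc t l =
    fails-at-suc (#≤ t l) (#≤ 1 (large t l)) t (countsOk-sound t l ok t ≤-refl)

  failures : ℕ → ℕ → ℕ → ℕ
  failures t s n = total (firstFail t) (seqs s n)

  failTerm : ℕ → ℕ → ℕ → ℕ
  failTerm n s t = (n C t) * PF t * (s ∸ t ∸ 1) ^ (n ∸ t)

  failures-split : ∀ t u n → failures t (t + u) n ≡ (n C t) * PF t * (u ∸ 1) ^ (n ∸ t)
  failures-split t u n = begin
    failures t (t + u) n
      ≡⟨ total-cong (seqs (t + u) n) (firstFail-factors t) ⟩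
    total (λ l → isPF t (small t l) * avoids1 (large t l)) (seqs (t + u) n)
      ≡⟨ split-count t u n (isPF t) avoids1 ⟩
    conv n (λ r → total (isPF t) (seqs t r)) (λ r → total avoids1 (seqs u r))
      ≡⟨ conv-cong n (total-isPF t) (total-avoids1 u) ⟩
    conv n (δ t (PF t)) (λ r → (u ∸ 1) ^ r)
      ≡⟨ conv-δ n t (PF t) (λ r → (u ∸ 1) ^ r) ⟩
    (n C t) * PF t * (u ∸ 1) ^ (n ∸ t) ∎
    where open ≡-Reasoning

  #≤-all : ∀ s i l → All (_≤ s) l → s ≤ i → #≤ i l ≡ length l
  #≤-all s i []      []           _   = refl
  #≤-all s i (a ∷ l) (a≤s ∷ all≤) s≤i rewrite 𝟙≤ (≤-trans a≤s s≤i) = cong suc (#≤-all s i l all≤ s≤i)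

  failures-vanish : ∀ t s n → s ≤ t → t < n → failures t s n ≡ 0
  failures-vanish t s n s≤t t<n = trans (total-seqs-cong s n never) (total-zero (seqs s n))
    where
    never : ∀ l → length l ≡ n → All (_≤ s) l → firstFail t l ≡ 0
    never l len all≤ rewrite #≤-all s (suc t) l all≤ (m≤n⇒m≤1+n s≤t) | len | ≤⇒≤ᵇ-true t<n =
      cong 𝟙 (∧-zeroʳ (countsOk t l))

  failTerm-vanish : ∀ n s t → s ≤ t → t < n → failTerm n s t ≡ 0
  failTerm-vanish n s t s≤t t<n = begin
    (n C t) * PF t * (s ∸ t ∸ 1) ^ (n ∸ t)   ≡⟨ cong (λ y → (n C t) * PF t * (y ∸ 1) ^ (n ∸ t)) (m≤n⇒m∸n≡0 s≤t) ⟩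
    (n C t) * PF t * 0 ^ (n ∸ t)             ≡⟨ cong (λ e → (n C t) * PF t * 0 ^ e) (∸-suc n t t<n) ⟩
    (n C t) * PF t * 0                       ≡⟨ *-zeroʳ ((n C t) * PF t) ⟩
    0                                        ∎
    where open ≡-Reasoning

  failures-count : ∀ n s t → t ≤ s ⊎ t < n → failures t s n ≡ failTerm n s t
  failures-count n s t (inj₁ t≤s) =
    subst (λ x → failures t x n ≡ failTerm n x t) (m+[n∸m]≡n t≤s)
      (trans (failures-split t (s ∸ t) n) (cong (λ x → (n C t) * PF t * (x ∸ 1) ^ (n ∸ t)) (sym (m+n∸m≡n t (s ∸ t)))))
  failures-count n s t (inj₂ t<n) with t ≤? s
  ... | yes t≤s = failures-count n s t (inj₁ t≤s)
  ... | no t≰s  = trans (failures-vanish t s n s≤t t<n) (sym (failTerm-vanish n s t s≤t t<n))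
    where
    s≤t : s ≤ t
    s≤t = <⇒≤ (≰⇒> t≰s)

  counted : ℕ → ℕ → ℕ → ℕ
  counted u s n = total (𝟙 ∘ countsOk u) (seqs s n)

  counted-suc : ∀ u s n → counted u s n ≡ counted (suc u) s n + failures u s n
  counted-suc u s n = trans (total-cong (seqs s n) passes-or-fails) (total-+ _ _ (seqs s n))
    where
    passes-or-fails : ∀ l → 𝟙 (countsOk u l) ≡ 𝟙 (countsOk (suc u) l) + firstFail u l
    passes-or-fails l with countsOk u l | suc u ≤ᵇ #≤ (suc u) l
    ... | true  | true  = refl
    ... | true  | false = refl
    ... | false | _     = refl

  telescope : ∀ s n u → s ^ n ≡ counted u s n + Σ< u (λ t → failures t s n)
  telescope s n zero    = trans (sym (#seqs s n)) (sym (+-identityʳ _))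
  telescope s n (suc u) = begin
    s ^ n                                          ≡⟨ telescope s n u ⟩
    counted u s n + Σ< u F                         ≡⟨ cong (_+ Σ< u F) (counted-suc u s n) ⟩
    counted (suc u) s n + F u + Σ< u F             ≡⟨ +-assoc (counted (suc u) s n) (F u) _ ⟩
    counted (suc u) s n + (F u + Σ< u F)           ≡⟨ cong (counted (suc u) s n +_) (+-comm (F u) _) ⟩
    counted (suc u) s n + (Σ< u F + F u)           ≡⟨ cong (counted (suc u) s n +_) (Σ<-last u F) ⟨
    counted (suc u) s n + Σ< (suc u) F             ∎
    where
    open ≡-Reasoning
    F : ℕ → ℕ
    F t = failures t s n

  length-filter : ∀ (f : List ℕ → Bool) xs → length (filter (λ x → f x ≟ᵇ true) xs) ≡ total (𝟙 ∘ f) xs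
  length-filter f []       = refl
  length-filter f (x ∷ xs) with f x
  ... | true  = cong suc (length-filter f xs)
  ... | false = length-filter f xs

  p≤≡counted : ∀ n s → p≤ n s ≡ counted n s n
  p≤≡counted n s = trans (length-filter (isParking n) (seqs s n))
                         (total-seqs-cong s n (λ l len _ → cong 𝟙 (isParking≡countsOk n l len)))

  first-failure : ∀ n s → s ^ n ≡ p≤ n s + Σ< n (failTerm n s)
  first-failure n s = trans (telescope s n n)
    (cong₂ _+_ (sym (p≤≡counted n s)) (Σ<-cong n (λ t t<n → failures-count n s t (inj₂ t<n))))

  -- For s > n every sequence fails somewhere, since at most n entries are ≤ n+1.
  first-failure-large : ∀ n s → n < s → s ^ n ≡ Σ< (suc n) (failTerm n s)
  first-failure-large n s n<s = trans (telescope s n (suc n))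
    (cong₂ _+_ none-pass (Σ<-cong (suc n) (λ t t≤n → failures-count n s t (inj₁ (≤-trans (≤-pred t≤n) (<⇒≤ n<s))))))
    where
    #≤≤length : ∀ i l → #≤ i l ≤ length l
    #≤≤length i []      = z≤n
    #≤≤length i (a ∷ l) with a ≤ᵇ i
    ... | true  = s≤s (#≤≤length i l)
    ... | false = m≤n⇒m≤1+n (#≤≤length i l)
    fails : ∀ l → length l ≡ n → All (_≤ s) l → 𝟙 (countsOk (suc n) l) ≡ 0
    fails l len _ rewrite ≰⇒≤ᵇ-false (λ 1+n≤ → 1+n≰n (≤-trans 1+n≤ (subst (#≤ (suc n) l ≤_) len (#≤≤length (suc n) l)))) =
      cong 𝟙 (∧-zeroʳ (countsOk n l))
    none-pass : counted (suc n) s n ≡ 0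
    none-pass = trans (total-seqs-cong s n fails) (total-zero (seqs s n))

-- Deg≤ d f says
-- that the (d+1)-st forward difference of f vanishes, i.e. f is a polynomial
-- function of degree ≤ d.
module FiniteDifferences where

  open import Data.Nat as ℕ using (ℕ; zero; suc; _≤_; z≤n; s≤s)
  import Data.Nat.Properties as ℕ
  open import Data.Integer using (ℤ; +_; -[1+_]; _+_; _*_; _-_; 0ℤ; 1ℤ; _^_)
  open import Data.Integer.Properties
  open import Data.Integer.Tactic.RingSolver using (solve-∀)
  open import Relation.Binary.PropositionalEquality

  Δ : (ℤ → ℤ) → ℤ → ℤ
  Δ f z = f (z + 1ℤ) - f z

  data Deg≤ : ℕ → (ℤ → ℤ) → Set where
    constant : ∀ {f}   → (∀ z → Δ f z ≡ 0ℤ) → Deg≤ zero f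
    Δ-lowers : ∀ {d f} → Deg≤ d (Δ f)        → Deg≤ (suc d) f

  Deg≤-ext : ∀ {d f g} → (∀ z → f z ≡ g z) → Deg≤ d f → Deg≤ d g
  Deg≤-ext f≗g (constant Δf≡0) = constant (λ z → trans (sym (cong₂ _-_ (f≗g (z + 1ℤ)) (f≗g z))) (Δf≡0 z))
  Deg≤-ext f≗g (Δ-lowers deg)  = Δ-lowers (Deg≤-ext (λ z → cong₂ _-_ (f≗g (z + 1ℤ)) (f≗g z)) deg)

  Δ-+ : ∀ a b c d → (a + b) - (c + d) ≡ (a - c) + (b - d)
  Δ-+ = solve-∀

  Deg≤-+ : ∀ {d f g} → Deg≤ d f → Deg≤ d g → Deg≤ d (λ z → f z + g z)
  Deg≤-+ {f = f} {g} (constant p) (constant q) =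
    constant (λ z → trans (Δ-+ (f (z + 1ℤ)) (g (z + 1ℤ)) (f z) (g z)) (cong₂ _+_ (p z) (q z)))
  Deg≤-+ {f = f} {g} (Δ-lowers p) (Δ-lowers q) =
    Δ-lowers (Deg≤-ext (λ z → sym (Δ-+ (f (z + 1ℤ)) (g (z + 1ℤ)) (f z) (g z))) (Deg≤-+ p q))

  Δ-* : ∀ c a b → c * a - c * b ≡ c * (a - b)
  Δ-* = solve-∀

  Deg≤-scale : ∀ {d} c {f} → Deg≤ d f → Deg≤ d (λ z → c * f z)
  Deg≤-scale c {f} (constant p) = constant (λ z → trans (Δ-* c (f (z + 1ℤ)) (f z)) (trans (cong (c *_) (p z)) (*-zeroʳ c)))
  Deg≤-scale c {f} (Δ-lowers p) = Δ-lowers (Deg≤-ext (λ z → sym (Δ-* c (f (z + 1ℤ)) (f z))) (Deg≤-scale c p))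

  Deg≤-suc : ∀ {d f} → Deg≤ d f → Deg≤ (suc d) f
  Deg≤-suc (constant p) = Δ-lowers (constant (λ z → cong₂ _-_ (p (z + 1ℤ)) (p z)))
  Deg≤-suc (Δ-lowers p) = Δ-lowers (Deg≤-suc p)

  Deg≤-mono : ∀ {d e f} → d ≤ e → Deg≤ d f → Deg≤ e f
  Deg≤-mono {e = zero}  z≤n     p            = p
  Deg≤-mono {e = suc e} z≤n     p            = Deg≤-suc (Deg≤-mono {e = e} z≤n p)
  Deg≤-mono             (s≤s q) (Δ-lowers p) = Δ-lowers (Deg≤-mono q p)

  Deg≤-const : ∀ d c → Deg≤ d (λ _ → c)
  Deg≤-const zero    c = constant (λ _ → +-inverseʳ c)
  Deg≤-const (suc d) c = Deg≤-suc (Deg≤-const d c)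

  shift-comm : ∀ z c → z + 1ℤ + c ≡ z + c + 1ℤ
  shift-comm = solve-∀

  Deg≤-shift : ∀ {d} c {f} → Deg≤ d f → Deg≤ d (λ z → f (z + c))
  Deg≤-shift c {f} (constant p) = constant (λ z → trans (cong (λ w → f w - f (z + c)) (shift-comm z c)) (p (z + c)))
  Deg≤-shift c {f} (Δ-lowers p) =
    Δ-lowers (Deg≤-ext (λ z → cong (λ w → f w - f (z + c)) (sym (shift-comm z c))) (Deg≤-shift c p))

  constant-value : ∀ {f} → Deg≤ 0 f → ∀ z → f z ≡ f 0ℤ
  constant-value {f} (constant p) = go
    where
    step : ∀ w → f (w + 1ℤ) ≡ f w
    step w = i-j≡0⇒i≡j _ _ (p w)
    shift : ∀ z k → f (z + + k) ≡ f z
    shift z zero    = cong f (+-identityʳ z)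
    shift z (suc k) = trans (cong f (trans (cong (λ w → z + w) (pos-+ 1 k)) (trans (cong (λ w → z + w) (+-comm 1ℤ (+ k)))
                                   (sym (+-assoc z (+ k) 1ℤ)))))
                            (trans (step (z + + k)) (shift z k))
    go : ∀ z → f z ≡ f 0ℤ
    go (+ a)      = trans (cong f (sym (+-identityˡ (+ a)))) (shift 0ℤ a)
    go -[1+ a ]   = sym (trans (cong f (sym (+-inverseˡ (+ suc a)))) (shift -[1+ a ] (suc a)))

  Δ-product : ∀ a a′ b b′ → a′ * b′ - a * b ≡ (a′ - a) * b′ + a * (b′ - b)
  Δ-product = solve-∀

  -- Degrees add under multiplication (discrete Leibniz rule).
  Deg≤-* : ∀ a b {f g} → Deg≤ a f → Deg≤ b g → Deg≤ (a ℕ.+ b) (λ z → f z * g z)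
  Deg≤-* zero b {f} {g} df dg = Deg≤-ext (λ z → cong (_* g z) (sym (constant-value df z))) (Deg≤-scale (f 0ℤ) dg)
  Deg≤-* (suc a) zero {f} {g} df dg =
    subst (λ d → Deg≤ d (λ z → f z * g z)) (sym (ℕ.+-identityʳ (suc a)))
      (Deg≤-ext (λ z → *-comm (g z) (f z)) (Deg≤-* zero (suc a) dg df))
  Deg≤-* (suc a) (suc b) {f} {g} (Δ-lowers dΔf) dg@(Δ-lowers dΔg) =
    Δ-lowers (Deg≤-ext (λ z → sym (Δ-product (f z) (f (z + 1ℤ)) (g z) (g (z + 1ℤ))))
      (Deg≤-+ (Deg≤-* a (suc b) dΔf (Deg≤-shift 1ℤ dg))
              (subst (λ d → Deg≤ d (λ z → f z * Δ g z)) (sym (ℕ.+-suc a b))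
                     (Deg≤-* (suc a) b {f} {Δ g} (Δ-lowers dΔf) dΔg))))

  Δ-linear : ∀ z c → (z + 1ℤ + c) - (z + c) ≡ 1ℤ
  Δ-linear = solve-∀

  Deg≤-power : ∀ n c → Deg≤ n (λ z → (z + c) ^ n)
  Deg≤-power zero    c = Deg≤-const 0 1ℤ
  Deg≤-power (suc n) c = Deg≤-* 1 n linear (Deg≤-power n c)
    where
    linear : Deg≤ 1 (λ z → z + c)
    linear = Δ-lowers (constant (λ z → trans (cong₂ _-_ (Δ-linear (z + 1ℤ) c) (Δ-linear z c)) (+-inverseʳ 1ℤ)))

  vanish : ∀ d N {f} → Deg≤ d f → (∀ m → f (+ (N ℕ.+ m)) ≡ 0ℤ) → ∀ z → f z ≡ 0ℤ
  vanish zero    N {f} df          zeros z = trans (constant-value df z) (trans (sym (constant-value df (+ (N ℕ.+ 0)))) (zeros 0))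
  vanish (suc d) N {f} (Δ-lowers p) zeros = vanish zero N {f} (constant (vanish d N p Δ-zeros)) zeros
    where
    Δ-zeros : ∀ m → Δ f (+ (N ℕ.+ m)) ≡ 0ℤ
    Δ-zeros m = cong₂ _-_ (trans (cong f (trans (sym (pos-+ (N ℕ.+ m) 1))
                                                 (cong +_ (trans (ℕ.+-assoc N m 1) (cong (N ℕ.+_) (ℕ.+-comm m 1))))))
                                 (zeros (suc m)))
                          (zeros m)

-- Binomial sums over ℤ.  binSum n g = Σ_{t ≤ n} C(n,t) · g t, defined by
-- the Pascal recursion; alternating binomial sums are iterated differences.
module BinomialSums where

  open import Defs using (sign; Σ≤)
  open import Data.Nat as ℕ using (ℕ; zero; suc; _≤_; _<_; z≤n; s≤s; _∸_)
  import Data.Nat.Properties as ℕ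
  open import Data.Nat.Combinatorics using (_C_; nCk+nC[k+1]≡[n+1]C[k+1]; k>n⇒nCk≡0)
  open import Data.Integer using (ℤ; +_; _+_; _*_; -_; _-_; 0ℤ; 1ℤ)
  open import Data.Integer.Properties
  open import Data.Integer.Tactic.RingSolver using (solve-∀)
  open import Data.List using (foldr)
  open import Function using (_∘_; id)
  open import Relation.Binary.PropositionalEquality
  open RangeSum +-0-isCommutativeMonoid
  open FiniteDifferences

  Σ≤-Σ< : ∀ m f → Σ≤ m f ≡ Σ< (suc m) f
  Σ≤-Σ< m f = trans (cong (foldr _+_ 0ℤ) (map-applyUpTo f id (suc m))) (foldr-applyUpTo f (suc m))

  binSum : ℕ → (ℕ → ℤ) → ℤ
  binSum zero    g = g 0
  binSum (suc n) g = binSum n g + binSum n (g ∘ suc)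

  binSum-cong : ∀ n {g g′} → (∀ t → t ≤ n → g t ≡ g′ t) → binSum n g ≡ binSum n g′
  binSum-cong zero    eq = eq 0 z≤n
  binSum-cong (suc n) eq = cong₂ _+_ (binSum-cong n (λ t t≤n → eq t (ℕ.m≤n⇒m≤1+n t≤n)))
                                     (binSum-cong n (λ t t≤n → eq (suc t) (s≤s t≤n)))

  binSum-neg : ∀ n g → binSum n (λ t → - g t) ≡ - binSum n g
  binSum-neg zero    g = refl
  binSum-neg (suc n) g = trans (cong₂ _+_ (binSum-neg n g) (binSum-neg n (g ∘ suc)))
                               (sym (neg-distrib-+ (binSum n g) (binSum n (g ∘ suc))))

  cancel-left : ∀ a b c → (a + b) - (a + c) ≡ b - c
  cancel-left = solve-∀

  -- Two binomial sums whose terms agree below n differ by their last terms (C(n,n) = 1).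
  binSum-last : ∀ n g g′ → (∀ t → t < n → g t ≡ g′ t) → binSum n g - binSum n g′ ≡ g n - g′ n
  binSum-last zero    g g′ eq = refl
  binSum-last (suc n) g g′ eq = begin
    (binSum n g + binSum n (g ∘ suc)) - (binSum n g′ + binSum n (g′ ∘ suc))
      ≡⟨ cong (λ x → (binSum n g + binSum n (g ∘ suc)) - (x + binSum n (g′ ∘ suc)))
              (binSum-cong n (λ t t≤n → eq t (s≤s t≤n))) ⟨
    (binSum n g + binSum n (g ∘ suc)) - (binSum n g + binSum n (g′ ∘ suc))
      ≡⟨ cancel-left (binSum n g) _ _ ⟩
    binSum n (g ∘ suc) - binSum n (g′ ∘ suc)
      ≡⟨ binSum-last n (g ∘ suc) (g′ ∘ suc) (λ t t<n → eq (suc t) (s≤s t<n)) ⟩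
    g (suc n) - g′ (suc n) ∎
    where open ≡-Reasoning

  binomial-expansion : ∀ n g → Σ< (suc n) (λ t → + (n C t) * g t) ≡ binSum n g
  binomial-expansion zero    g = trans (+-identityʳ _) (*-identityˡ (g 0))
  binomial-expansion (suc n) g = begin
    + 1 * g 0 + Σ< (suc n) (λ t → + (suc n C suc t) * g (suc t))
      ≡⟨ cong (λ x → + 1 * g 0 + x) (trans (Σ<-cong (suc n) (λ t _ → pascal t)) (Σ<-+ (suc n) left right)) ⟩
    + 1 * g 0 + (Σ< (suc n) left + Σ< (suc n) right)
      ≡⟨ cong (λ x → + 1 * g 0 + (Σ< (suc n) left + x)) (Σ<-last n right) ⟩
    + 1 * g 0 + (Σ< (suc n) left + (Σ< n right + right n))
      ≡⟨ cong (λ x → + 1 * g 0 + (Σ< (suc n) left + (Σ< n right + x))) last-vanishes ⟩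
    + 1 * g 0 + (Σ< (suc n) left + (Σ< n right + 0ℤ))
      ≡⟨ regroup (g 0) (Σ< (suc n) left) (Σ< n right) ⟩
    (+ 1 * g 0 + Σ< n right) + Σ< (suc n) left
      ≡⟨ cong₂ _+_ (binomial-expansion n g) (binomial-expansion n (g ∘ suc)) ⟩
    binSum n g + binSum n (g ∘ suc) ∎
    where
    open ≡-Reasoning
    left right : ℕ → ℤ
    left  t = + (n C t) * g (suc t)
    right t = + (n C suc t) * g (suc t)
    pascal : ∀ t → + (suc n C suc t) * g (suc t) ≡ left t + right t
    pascal t = trans (cong (λ c → + c * g (suc t)) (sym (nCk+nC[k+1]≡[n+1]C[k+1] n t)))
                     (trans (cong (_* g (suc t)) (pos-+ (n C t) (n C suc t))) (*-distribʳ-+ (g (suc t)) (+ (n C t)) (+ (n C suc t))))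
    last-vanishes : right n ≡ 0ℤ
    last-vanishes = trans (cong (λ c → + c * g (suc n)) (k>n⇒nCk≡0 (ℕ.n<1+n n))) (*-zeroˡ (g (suc n)))
    regroup : ∀ a L R → + 1 * a + (L + (R + 0ℤ)) ≡ (+ 1 * a + R) + L
    regroup = solve-∀

  Δ^ : ℕ → (ℤ → ℤ) → ℤ → ℤ
  Δ^ zero    f z = f z
  Δ^ (suc n) f z = Δ^ n f (z + 1ℤ) - Δ^ n f z

  Δ^-Δ : ∀ n f z → Δ^ n (Δ f) z ≡ Δ^ (suc n) f z
  Δ^-Δ zero    f z = refl
  Δ^-Δ (suc n) f z = cong₂ _-_ (Δ^-Δ n f (z + 1ℤ)) (Δ^-Δ n f z)

  Δ^-vanish : ∀ d f → Deg≤ d f → ∀ m z → Δ^ (suc (d ℕ.+ m)) f z ≡ 0ℤ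
  Δ^-vanish zero    f (constant p) zero    z = p z
  Δ^-vanish zero    f (constant p) (suc m) z = cong₂ _-_ (Δ^-vanish zero f (constant p) m (z + 1ℤ))
                                                        (Δ^-vanish zero f (constant p) m z)
  Δ^-vanish (suc d) f (Δ-lowers p) m z = trans (sym (Δ^-Δ (suc (d ℕ.+ m)) f z)) (Δ^-vanish d (Δ f) p m z)

  sign-suc-∸ : ∀ n t → t ≤ n → sign (suc n ∸ t) ≡ - sign (n ∸ t)
  sign-suc-∸ n       zero    _       = refl
  sign-suc-∸ (suc n) (suc t) (s≤s p) = sign-suc-∸ n t p

  neg-* : ∀ a b → - a * b ≡ - (a * b)
  neg-* = solve-∀

  -neg+ : ∀ a b → - a + b ≡ b - a
  -neg+ = solve-∀

  alternating-binSum : ∀ n f z → binSum n (λ t → sign (n ∸ t) * f (z + + t)) ≡ Δ^ n f z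
  alternating-binSum zero    f z = trans (*-identityˡ _) (cong f (+-identityʳ z))
  alternating-binSum (suc n) f z = begin
    binSum n (λ t → sign (suc n ∸ t) * f (z + + t)) + binSum n (λ t → sign (n ∸ t) * f (z + + suc t))
      ≡⟨ cong₂ _+_ (trans (binSum-cong n (λ t t≤n → trans (cong (_* f (z + + t)) (sign-suc-∸ n t t≤n))
                                                          (neg-* (sign (n ∸ t)) _)))
                          (binSum-neg n _))
                   (binSum-cong n (λ t _ → cong (λ w → sign (n ∸ t) * f w) (shift t))) ⟩
    - binSum n (λ t → sign (n ∸ t) * f (z + + t)) + binSum n (λ t → sign (n ∸ t) * f (z + 1ℤ + + t))
      ≡⟨ cong₂ (λ a b → - a + b) (alternating-binSum n f z) (alternating-binSum n f (z + 1ℤ)) ⟩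
    - Δ^ n f z + Δ^ n f (z + 1ℤ)
      ≡⟨ -neg+ (Δ^ n f z) (Δ^ n f (z + 1ℤ)) ⟩
    Δ^ (suc n) f z ∎
    where
    open ≡-Reasoning
    shift : ∀ t → z + + suc t ≡ z + 1ℤ + + t
    shift t = trans (cong (λ w → z + w) (pos-+ 1 t)) (sym (+-assoc z 1ℤ (+ t)))

  Deg≤-binSum : ∀ n d (h : ℕ → ℤ → ℤ) → (∀ t → t ≤ n → Deg≤ d (h t)) → Deg≤ d (λ z → binSum n (λ t → h t z))
  Deg≤-binSum zero    d h deg = deg 0 z≤n
  Deg≤-binSum (suc n) d h deg = Deg≤-+ (Deg≤-binSum n d h (λ t t≤n → deg t (ℕ.m≤n⇒m≤1+n t≤n)))
                                        (Deg≤-binSum n d (h ∘ suc) (λ t t≤n → deg (suc t) (s≤s t≤n)))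

-- For naturals z ≥ n it is the first-failure decomposition
-- of {1,…,z+1}ⁿ; both sides are polynomial functions of z of degree ≤ n, so it
-- holds identically.
module AbelIdentity where

  open import Defs using (sign)
  open import Data.Nat as ℕ using (ℕ; zero; suc; _≤_; s≤s; _∸_)
  import Data.Nat.Properties as ℕ
  open import Data.Nat.Combinatorics using (_C_)
  open import Data.Integer using (ℤ; +_; _+_; _*_; -_; _-_; 0ℤ; 1ℤ; -1ℤ; _^_)
  open import Data.Integer.Properties
  open import Data.Integer.Tactic.RingSolver using (solve-∀)
  open import Function using (_∘_)
  open import Relation.Binary.PropositionalEquality
  open FirstFailure using (PF; failTerm; first-failure-large)
  open FiniteDifferences
  open BinomialSums
  module ℕΣ = RangeSum ℕ.+-0-isCommutativeMonoid
  open RangeSum +-0-isCommutativeMonoid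

  pos-Σ< : ∀ n (f : ℕ → ℕ) → + (ℕΣ.Σ< n f) ≡ Σ< n (+_ ∘ f)
  pos-Σ< zero    f = refl
  pos-Σ< (suc n) f = trans (pos-+ (f 0) _) (cong (λ w → + f 0 + w) (pos-Σ< n (f ∘ suc)))

  pos-^ : ∀ a k → + (a ℕ.^ k) ≡ (+ a) ^ k
  pos-^ a zero    = refl
  pos-^ a (suc k) = trans (pos-* a (a ℕ.^ k)) (cong (λ w → + a * w) (pos-^ a k))

  neg-^ : ∀ x k → (- x) ^ k ≡ sign k * x ^ k
  neg-^ x zero    = refl
  neg-^ x (suc k) = trans (cong (λ w → - x * w) (neg-^ x k)) (swap x (sign k) (x ^ k))
    where
    swap : ∀ x s y → - x * (s * y) ≡ - s * (x * y)
    swap = solve-∀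

  abelTerm : ℕ → ℤ → ℕ → ℤ
  abelTerm n z t = + PF t * (z - + t) ^ (n ∸ t)

  abelSum : ℕ → ℤ → ℤ
  abelSum n z = binSum n (abelTerm n z)

  failTerm≡abelTerm : ∀ n m t → t ≤ m → + failTerm n (suc m) t ≡ + (n C t) * abelTerm n (+ m) t
  failTerm≡abelTerm n m t t≤m = begin
    + ((n C t) ℕ.* PF t ℕ.* (suc m ∸ t ∸ 1) ℕ.^ (n ∸ t))
      ≡⟨ trans (pos-* ((n C t) ℕ.* PF t) _) (cong (_* + ((suc m ∸ t ∸ 1) ℕ.^ (n ∸ t))) (pos-* (n C t) (PF t))) ⟩
    + (n C t) * + PF t * + ((suc m ∸ t ∸ 1) ℕ.^ (n ∸ t))
      ≡⟨ *-assoc (+ (n C t)) (+ PF t) _ ⟩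
    + (n C t) * (+ PF t * + ((suc m ∸ t ∸ 1) ℕ.^ (n ∸ t)))
      ≡⟨ cong (λ x → + (n C t) * (+ PF t * x)) (trans (cong (λ y → + (y ℕ.^ (n ∸ t))) base) (pos-^ (m ∸ t) (n ∸ t))) ⟩
    + (n C t) * (+ PF t * (+ (m ∸ t)) ^ (n ∸ t))
      ≡⟨ cong (λ x → + (n C t) * (+ PF t * x ^ (n ∸ t))) (sym (trans (m-n≡m⊖n m t) (⊖-≥ t≤m))) ⟩
    + (n C t) * abelTerm n (+ m) t ∎
    where
    open ≡-Reasoning
    base : suc m ∸ t ∸ 1 ≡ m ∸ t
    base = trans (ℕ.∸-+-assoc (suc m) t 1) (cong (suc m ∸_) (ℕ.+-comm t 1))

  abel-at-naturals : ∀ n m → n ≤ m → abelSum n (+ m) ≡ (+ m + 1ℤ) ^ n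
  abel-at-naturals n m n≤m = sym (begin
    (+ m + 1ℤ) ^ n                                  ≡⟨ cong (_^ n) (trans (sym (pos-+ m 1)) (cong +_ (ℕ.+-comm m 1))) ⟩
    (+ suc m) ^ n                                   ≡⟨ pos-^ (suc m) n ⟨
    + (suc m ℕ.^ n)                                 ≡⟨ cong +_ (first-failure-large n (suc m) (s≤s n≤m)) ⟩
    + ℕΣ.Σ< (suc n) (failTerm n (suc m))            ≡⟨ pos-Σ< (suc n) (failTerm n (suc m)) ⟩
    Σ< (suc n) (λ t → + failTerm n (suc m) t)       ≡⟨ Σ<-cong (suc n) (λ t t≤n → failTerm≡abelTerm n m t (ℕ.≤-trans (ℕ.≤-pred t≤n) n≤m)) ⟩
    Σ< (suc n) (λ t → + (n C t) * abelTerm n (+ m) t) ≡⟨ binomial-expansion n (abelTerm n (+ m)) ⟩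
    abelSum n (+ m)                                 ∎)
    where open ≡-Reasoning

  abel : ∀ n z → abelSum n z ≡ (z + 1ℤ) ^ n
  abel n z = i-j≡0⇒i≡j _ _ (vanish n n difference-degree zeros z)
    where
    difference-degree : Deg≤ n (λ z → abelSum n z - (z + 1ℤ) ^ n)
    difference-degree = Deg≤-+ (Deg≤-binSum n n (λ t z → abelTerm n z t)
                                  (λ t _ → Deg≤-mono (ℕ.m∸n≤m n t) (Deg≤-scale (+ PF t) (Deg≤-power (n ∸ t) (- + t)))))
                               (Deg≤-ext (λ z → -1*i≡-i ((z + 1ℤ) ^ n)) (Deg≤-scale -1ℤ (Deg≤-power n 1ℤ)))
    zeros : ∀ m → abelSum n (+ (n ℕ.+ m)) - (+ (n ℕ.+ m) + 1ℤ) ^ n ≡ 0ℤ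
    zeros m = trans (cong (_- (+ (n ℕ.+ m) + 1ℤ) ^ n) (abel-at-naturals n (n ℕ.+ m) (ℕ.m≤m+n n m)))
                    (+-inverseʳ ((+ (n ℕ.+ m) + 1ℤ) ^ n))

-- At
-- z = −1 the Abel identity gives Σ_{t ≤ n} C(n,t) PF(t) (−1 − t)^(n−t) = 0.  If the
-- formula holds below n, the terms with t < n are C(n,t) (−1)^(n−t) (t+1)^(n−1),
-- exactly those of the n-th difference of (z+1)^(n−1), which also sums to 0; so
-- the remaining terms t = n agree as well.
module Cayley where

  open import Defs using (sign)
  open import Data.Nat as ℕ using (ℕ; zero; suc; _≤_; _<_; _∸_)
  import Data.Nat.Properties as ℕ
  open import Data.Nat.Induction using (<-rec)
  open import Data.Integer using (ℤ; +_; _+_; _*_; -_; _-_; 0ℤ; 1ℤ; -1ℤ; _^_)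
  open import Data.Integer.Properties
  open import Data.Integer.Tactic.RingSolver using (solve-∀)
  open import Relation.Binary.PropositionalEquality
  open FirstFailure using (PF)
  open FiniteDifferences
  open BinomialSums
  open AbelIdentity

  CayleyFormula : ℕ → Set
  CayleyFormula t = PF t ≡ suc t ℕ.^ (t ∸ 1)

  -- The terms of the n-th difference of (z+1)^(n−1) at 0.
  cayleyTerm : ℕ → ℕ → ℤ
  cayleyTerm n t = sign (n ∸ t) * (+ suc t) ^ (n ∸ 1)

  cayleyTerms-vanish : ∀ n → binSum (suc n) (cayleyTerm (suc n)) ≡ 0ℤ
  cayleyTerms-vanish n = begin
    binSum (suc n) (cayleyTerm (suc n))
      ≡⟨ binSum-cong (suc n) (λ t _ → cong (λ w → sign (suc n ∸ t) * w ^ n) (trans (pos-+ 1 t) (as-shift (+ t)))) ⟩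
    binSum (suc n) (λ t → sign (suc n ∸ t) * (0ℤ + + t + 1ℤ) ^ n)
      ≡⟨ alternating-binSum (suc n) (λ z → (z + 1ℤ) ^ n) 0ℤ ⟩
    Δ^ (suc n) (λ z → (z + 1ℤ) ^ n) 0ℤ
      ≡⟨ cong (λ e → Δ^ (suc e) (λ z → (z + 1ℤ) ^ n) 0ℤ) (ℕ.+-identityʳ n) ⟨
    Δ^ (suc (n ℕ.+ 0)) (λ z → (z + 1ℤ) ^ n) 0ℤ
      ≡⟨ Δ^-vanish n _ (Deg≤-power n 1ℤ) 0 0ℤ ⟩
    0ℤ ∎
    where
    open ≡-Reasoning
    as-shift : ∀ a → 1ℤ + a ≡ 0ℤ + a + 1ℤ
    as-shift = solve-∀

  -1-t : ∀ t → -1ℤ - + t ≡ - (+ suc t)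
  -1-t t = trans (sym (neg-distrib-+ 1ℤ (+ t))) (cong -_ (sym (pos-+ 1 t)))

  abelTerm-at-−1 : ∀ n t → t ≤ n → CayleyFormula t → abelTerm n -1ℤ t ≡ cayleyTerm n t
  abelTerm-at-−1 n zero _ PF0 = begin
    + PF 0 * (-1ℤ - 0ℤ) ^ n         ≡⟨ *-identityˡ _ ⟩
    -1ℤ ^ n                          ≡⟨ neg-^ 1ℤ n ⟩
    sign n * 1ℤ ^ n                  ≡⟨ cong (sign n *_) (trans (^-zeroˡ n) (sym (^-zeroˡ (n ∸ 1)))) ⟩
    sign n * 1ℤ ^ (n ∸ 1)            ∎
    where open ≡-Reasoning
  abelTerm-at-−1 n (suc t) t<n PF≡ = begin
    + PF (suc t) * (-1ℤ - + suc t) ^ (n ∸ suc t)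
      ≡⟨ cong₂ (λ a b → + a * b ^ (n ∸ suc t)) PF≡ (-1-t (suc t)) ⟩
    + (suc (suc t) ℕ.^ t) * (- x) ^ (n ∸ suc t)
      ≡⟨ cong₂ _*_ (pos-^ (suc (suc t)) t) (neg-^ x (n ∸ suc t)) ⟩
    x ^ t * (sign (n ∸ suc t) * x ^ (n ∸ suc t))
      ≡⟨ reorder (x ^ t) (sign (n ∸ suc t)) (x ^ (n ∸ suc t)) ⟩
    sign (n ∸ suc t) * (x ^ t * x ^ (n ∸ suc t))
      ≡⟨ cong (sign (n ∸ suc t) *_) (^-distribˡ-+-* x t (n ∸ suc t)) ⟨
    sign (n ∸ suc t) * x ^ (t ℕ.+ (n ∸ suc t))
      ≡⟨ cong (λ e → sign (n ∸ suc t) * x ^ e) exponent ⟩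
    cayleyTerm n (suc t) ∎
    where
    open ≡-Reasoning
    x : ℤ
    x = + suc (suc t)
    reorder : ∀ q s y → q * (s * y) ≡ s * (q * y)
    reorder = solve-∀
    exponent : t ℕ.+ (n ∸ suc t) ≡ n ∸ 1
    exponent = cong (ℕ._∸ 1) (ℕ.m+[n∸m]≡n t<n)

  cayley-step : ∀ n → (∀ {t} → t < n → CayleyFormula t) → CayleyFormula n
  cayley-step zero    _  = refl
  cayley-step (suc n) IH = +-injective (begin
    + PF (suc n)                                 ≡⟨ *-identityʳ (+ PF (suc n)) ⟨
    + PF (suc n) * 1ℤ                            ≡⟨ cong (λ e → + PF (suc n) * (-1ℤ - + suc n) ^ e) (ℕ.n∸n≡0 n) ⟨
    abelTerm (suc n) -1ℤ (suc n)                 ≡⟨ i-j≡0⇒i≡j _ _ last-terms ⟩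
    cayleyTerm (suc n) (suc n)                   ≡⟨ cong (λ e → sign e * (+ suc (suc n)) ^ n) (ℕ.n∸n≡0 n) ⟩
    1ℤ * (+ suc (suc n)) ^ n                     ≡⟨ *-identityˡ _ ⟩
    (+ suc (suc n)) ^ n                          ≡⟨ pos-^ (suc (suc n)) n ⟨
    + (suc (suc n) ℕ.^ n)                        ∎)
    where
    open ≡-Reasoning
    last-terms : abelTerm (suc n) -1ℤ (suc n) - cayleyTerm (suc n) (suc n) ≡ 0ℤ
    last-terms = begin
      abelTerm (suc n) -1ℤ (suc n) - cayleyTerm (suc n) (suc n)
        ≡⟨ binSum-last (suc n) _ _ (λ t t<n → abelTerm-at-−1 (suc n) t (ℕ.<⇒≤ t<n) (IH t<n)) ⟨
      abelSum (suc n) -1ℤ - binSum (suc n) (cayleyTerm (suc n))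
        ≡⟨ cong₂ _-_ (abel (suc n) -1ℤ) (cayleyTerms-vanish n) ⟩
      0ℤ ∎

  cayley : ∀ t → PF t ≡ suc t ℕ.^ (t ∸ 1)
  cayley = <-rec CayleyFormula cayley-step

-- For s = w + 1 and n = s + k, comparing the first-failure decomposition
-- of {1,…,s}ⁿ with the Abel identity at z = w, the terms t < s coincide, so
-- p_{n;≤s} is the sum of the Abel terms with s ≤ t ≤ n.
module ParkingTail where

  open import Defs using (p≤; sign; Σ≤)
  open import Algebra.Bundles using (AbelianGroup)
  open import Data.Nat as ℕ using (ℕ; suc; _≤_; _∸_)
  import Data.Nat.Properties as ℕ
  open import Data.Nat.Combinatorics using (_C_; nCk≡nC[n∸k])
  open import Data.Integer using (ℤ; +_; _+_; _*_; -_; _-_; 0ℤ; 1ℤ; _^_)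
  open import Data.Integer.Properties
  open import Data.Integer.Tactic.RingSolver using (solve-∀)
  open import Algebra.Properties.Group (AbelianGroup.group +-0-abelianGroup) using (∙-cancelˡ)
  open import Relation.Binary.PropositionalEquality
  open FirstFailure using (PF; failTerm; first-failure; failTerm-vanish)
  open BinomialSums
  open AbelIdentity using (abelTerm; abelSum; abel; failTerm≡abelTerm; pos-Σ<; pos-^; neg-^)
  open Cayley using (cayley)
  module ℕΣ = RangeSum ℕ.+-0-isCommutativeMonoid
  open RangeSum +-0-isCommutativeMonoid

  abelTerm-C : ℕ → ℕ → ℕ → ℤ
  abelTerm-C n w t = + (n C t) * abelTerm n (+ w) t

  parking-tail : ∀ n w k → suc w ℕ.+ k ≡ n → + p≤ n (suc w) ≡ Σ< (suc k) (λ j → abelTerm-C n w (suc w ℕ.+ j))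
  parking-tail .(suc w ℕ.+ k) w k refl = ∙-cancelˡ (Σ< s A) _ _ (begin
    Σ< s A + + p≤ n s
      ≡⟨ +-comm (Σ< s A) _ ⟩
    + p≤ n s + Σ< s A
      ≡⟨ cong (λ y → + p≤ n s + y) failures-below-s ⟨
    + p≤ n s + Σ< n F
      ≡⟨ trans (pos-+ (p≤ n s) _) (cong (λ y → + p≤ n s + y) (pos-Σ< n (failTerm n s))) ⟨
    + (p≤ n s ℕ.+ ℕΣ.Σ< n (failTerm n s))
      ≡⟨ cong +_ (first-failure n s) ⟨
    + (s ℕ.^ n)
      ≡⟨ trans (pos-^ s n) (cong (_^ n) (trans (pos-+ 1 w) (+-comm 1ℤ (+ w)))) ⟩
    (+ w + 1ℤ) ^ n
      ≡⟨ abel n (+ w) ⟨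
    abelSum n (+ w)
      ≡⟨ binomial-expansion n (abelTerm n (+ w)) ⟨
    Σ< (suc n) A
      ≡⟨ cong (λ m → Σ< m A) (ℕ.+-suc s k) ⟨
    Σ< (s ℕ.+ suc k) A
      ≡⟨ Σ<-split s (suc k) A ⟩
    Σ< s A + Σ< (suc k) (λ j → A (s ℕ.+ j)) ∎)
    where
    open ≡-Reasoning
    s n : ℕ
    s = suc w
    n = s ℕ.+ k
    A F : ℕ → ℤ
    A = abelTerm-C n w
    F t = + failTerm n s t
    -- below s the failure terms are the Abel terms; from s on they vanish
    failures-below-s : Σ< n F ≡ Σ< s A
    failures-below-s = begin
      Σ< (s ℕ.+ k) F                              ≡⟨ Σ<-split s k F ⟩
      Σ< s F + Σ< k (λ j → F (s ℕ.+ j))           ≡⟨ cong₂ _+_ (Σ<-cong s (λ t t<s → failTerm≡abelTerm n w t (ℕ.≤-pred t<s)))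
                                                               (Σ<-cong k (λ j j<k → cong +_ (failTerm-vanish n s (s ℕ.+ j)
                                                                  (ℕ.m≤m+n s j) (ℕ.+-monoʳ-< s j<k)))) ⟩
      Σ< s A + Σ< k (λ _ → 0ℤ)                    ≡⟨ cong (λ y → Σ< s A + y) (Σ<-zero k) ⟩
      Σ< s A + 0ℤ                                 ≡⟨ +-identityʳ (Σ< s A) ⟩
      Σ< s A                                      ∎

  term : ℕ → ℕ → ℕ → ℤ
  term n k i = sign i * + (n C i) * + ((n ∸ i ℕ.+ 1) ℕ.^ (n ∸ i ∸ 1)) * + ((k ℕ.+ 1 ∸ i) ℕ.^ i)

  -- Read from the top, the surviving Abel terms are the summands of the corollary:
  -- by Cayley's formula and the symmetry C(n, n − i) = C(n, i).
  abelTerm≡term : ∀ n w k i → suc w ℕ.+ k ≡ n → i ≤ k → abelTerm-C n w (suc w ℕ.+ (k ∸ i)) ≡ term n k i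
  abelTerm≡term .(suc w ℕ.+ k) w k i refl i≤k = begin
    abelTerm-C n w (suc w ℕ.+ (k ∸ i))
      ≡⟨ cong (abelTerm-C n w) index ⟩
    + (n C (n ∸ i)) * (+ PF (n ∸ i) * (+ w - + (n ∸ i)) ^ (n ∸ (n ∸ i)))
      ≡⟨ cong₂ (λ a b → + a * b) (sym (nCk≡nC[n∸k] i≤n))
               (cong₂ (λ a b → + a * b) cayley′ (cong₂ _^_ base (ℕ.m∸[m∸n]≡n i≤n))) ⟩
    + (n C i) * (+ ((n ∸ i ℕ.+ 1) ℕ.^ (n ∸ i ∸ 1)) * (- (+ x)) ^ i)
      ≡⟨ cong (λ y → + (n C i) * (+ ((n ∸ i ℕ.+ 1) ℕ.^ (n ∸ i ∸ 1)) * y))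
              (trans (neg-^ (+ x) i) (cong (sign i *_) (sym (pos-^ x i)))) ⟩
    + (n C i) * (+ ((n ∸ i ℕ.+ 1) ℕ.^ (n ∸ i ∸ 1)) * (sign i * + (x ℕ.^ i)))
      ≡⟨ reorder (+ (n C i)) _ (sign i) _ ⟩
    term n k i ∎
    where
    open ≡-Reasoning
    n x : ℕ
    n = suc w ℕ.+ k
    x = k ℕ.+ 1 ∸ i
    i≤n : i ≤ n
    i≤n = ℕ.≤-trans i≤k (ℕ.m≤n+m k (suc w))
    index : suc w ℕ.+ (k ∸ i) ≡ n ∸ i
    index = sym (ℕ.+-∸-assoc (suc w) i≤k)
    n∸i : n ∸ i ≡ w ℕ.+ x
    n∸i = trans (cong (ℕ._∸ i) (trans (sym (ℕ.+-suc w k)) (cong (w ℕ.+_) (ℕ.+-comm 1 k))))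
                (ℕ.+-∸-assoc w (ℕ.≤-trans i≤k (ℕ.m≤m+n k 1)))
    base : + w - + (n ∸ i) ≡ - (+ x)
    base = trans (cong (λ y → + w - y) (trans (cong +_ n∸i) (pos-+ w x))) (cancel (+ w) (+ x))
      where
      cancel : ∀ a b → a - (a + b) ≡ - b
      cancel = solve-∀
    cayley′ : PF (n ∸ i) ≡ (n ∸ i ℕ.+ 1) ℕ.^ (n ∸ i ∸ 1)
    cayley′ = trans (cayley (n ∸ i)) (cong (ℕ._^ (n ∸ i ∸ 1)) (ℕ.+-comm 1 (n ∸ i)))
    reorder : ∀ c p s y → c * (p * (s * y)) ≡ s * c * p * y
    reorder = solve-∀

  -- The corollary's sum may stop at i = k: the term i = k + 1 contains 0^(k+1).
  Σ≤-term : ∀ n k → Σ≤ (k ℕ.+ 1) (term n k) ≡ Σ< (suc k) (term n k)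
  Σ≤-term n k = begin
    Σ≤ (k ℕ.+ 1) (term n k)                     ≡⟨ Σ≤-Σ< (k ℕ.+ 1) (term n k) ⟩
    Σ< (suc (k ℕ.+ 1)) (term n k)               ≡⟨ cong (λ m → Σ< (suc m) (term n k)) (ℕ.+-comm k 1) ⟩
    Σ< (suc (suc k)) (term n k)                 ≡⟨ Σ<-last (suc k) (term n k) ⟩
    Σ< (suc k) (term n k) + term n k (suc k)    ≡⟨ cong (λ y → Σ< (suc k) (term n k) + y) beyond ⟩
    Σ< (suc k) (term n k) + 0ℤ                  ≡⟨ +-identityʳ _ ⟩
    Σ< (suc k) (term n k)                       ∎
    where
    open ≡-Reasoning
    beyond : term n k (suc k) ≡ 0ℤ
    beyond = trans (cong (λ b → sign (suc k) * + (n C suc k) * + ((n ∸ suc k ℕ.+ 1) ℕ.^ (n ∸ suc k ∸ 1)) * + (b ℕ.^ suc k))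
                         (trans (cong (ℕ._∸ suc k) (ℕ.+-comm k 1)) (ℕ.n∸n≡0 (suc k))))
                   (*-zeroʳ (sign (suc k) * + (n C suc k) * + ((n ∸ suc k ℕ.+ 1) ℕ.^ (n ∸ suc k ∸ 1))))

open import Defs
open import Data.Nat using (ℕ; _≤_; _∸_; _+_; _^_; suc)
open import Data.Nat.Properties using (≤-pred; +-comm; +-suc; m∸n+n≡m; m+n∸n≡m)
open import Data.Nat.Combinatorics using (_C_)
open import Data.Integer using (ℤ; +_; _*_)
open import Data.Integer.Properties using (+-0-isCommutativeMonoid)
open RangeSum +-0-isCommutativeMonoid using (Σ<; Σ<-reverse; Σ<-cong)
open ParkingTail using (abelTerm-C; term; parking-tail; abelTerm≡term; Σ≤-term)

-- With s = n − k = w + 1: p_{n;≤s} is the sum of the Abel terms t = s + j, j ≤ k,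
-- which read in reverse order (t = n − i) are the summands of the corollary.
corollary2p6 : (n k : ℕ) → k + 1 ≤ n →
    + p≤ n (n ∸ k) ≡
    Σ≤ (k + 1) (λ i → sign i * + (n C i) * + ((n ∸ i + 1) ^ (n ∸ i ∸ 1)) * + ((k + 1 ∸ i) ^ i))
corollary2p6 n k k+1≤n = begin
  + p≤ n (n ∸ k)                                       ≡⟨ cong (λ s → + p≤ n s) n∸k≡1+w ⟩
  + p≤ n (suc w)                                       ≡⟨ parking-tail n w k 1+w+k≡n ⟩
  Σ< (suc k) (λ j → abelTerm-C n w (suc w + j))        ≡⟨ Σ<-reverse (suc k) (λ j → abelTerm-C n w (suc w + j)) ⟩
  Σ< (suc k) (λ i → abelTerm-C n w (suc w + (k ∸ i)))  ≡⟨ Σ<-cong (suc k) (λ i i<1+k → abelTerm≡term n w k i 1+w+k≡n (≤-pred i<1+k)) ⟩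
  Σ< (suc k) (term n k)                                ≡⟨ Σ≤-term n k ⟨
  Σ≤ (k + 1) (term n k)                                ∎
  where
  open ≡-Reasoning
  w : ℕ
  w = n ∸ suc k
  1+w+k≡n : suc w + k ≡ n
  1+w+k≡n = trans (sym (+-suc w k)) (m∸n+n≡m (subst (_≤ n) (+-comm k 1) k+1≤n))
  n∸k≡1+w : n ∸ k ≡ suc w
  n∸k≡1+w = trans (cong (_∸ k) (sym 1+w+k≡n)) (m+n∸n≡m (suc w) k)
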